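{- If an s-hypersequent $\alpha_1\vdash\beta_1\mid\dots\mid\alpha_n\vdash\beta_n$ is provable in $\mathbf{PDBL}$, then it is valid in the class $\mathcal{K}$ of all contexts.
   Context: The logic PDBL. Variables: object variables $\mathbf{OV}$ ($p,\dots$) and property variables $\mathbf{PV}$ ($P,\dots$), disjoint countably infinite sets; constants $\top,\bot$; connectives $\sqcap,\sqcup$ (binary), $\neg,\lrcorner$ (unary). $\alpha\vee\beta:=\neg(\neg\alpha\sqcap\neg\beta)$, $\alpha\wedge\beta:=\lrcorner(\lrcorner\alpha\sqcup\lrcorner\beta)$. Sequents $\alpha\vdash\beta$ ($\alpha\dashv\vdash\beta$ means both directions); s-hypersequents are finite sequences $\alpha_1\vdash\beta_1\mid\dots\mid\alpha_n\vdash\beta_n$ (components); $B,C,\dots,X$ range over possibly empty s-hypersequents. Axioms: $\alpha\vdash\alpha$; $\alpha\sqcap\beta\vdash\alpha$; $\alpha\sqcap\beta\vdash\beta$; $\alpha\vdash\alpha\sqcup\beta$; $\beta\vdash\alpha\sqcup\beta$; $\alpha\sqcap\beta\vdash(\alpha\sqcap\beta)\sqcap(\alpha\sqcap\beta)$; $(\alpha\sqcup\beta)\sqcup(\alpha\sqcup\beta)\vdash\alpha\sqcup\beta$; $\neg(\alpha\sqcap\alpha)\vdash\neg\alpha$; $\lrcorner\alpha\vdash\lrcorner(\alpha\sqcup\alpha)$; $\alpha\sqcap\neg\alpha\vdash\bot$; $\top\vdash\alpha\sqcup\lrcorner\alpha$; $\neg\neg(\alpha\sqcap\beta)\dashv\vdash\alpha\sqcap\beta$;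 $\lrcorner\lrcorner(\alpha\sqcup\beta)\dashv\vdash\alpha\sqcup\beta$; $\alpha\sqcap\alpha\vdash\alpha\sqcap(\alpha\sqcup\beta)$; $\alpha\sqcup(\alpha\sqcap\beta)\vdash\alpha\sqcup\alpha$; $\alpha\sqcap\alpha\vdash\alpha\sqcap(\alpha\vee\beta)$; $\alpha\sqcup(\alpha\wedge\beta)\vdash\alpha\sqcup\alpha$; $\alpha\sqcap(\beta\vee\gamma)\dashv\vdash(\alpha\sqcap\beta)\vee(\alpha\sqcap\gamma)$; $\alpha\sqcup(\beta\wedge\gamma)\dashv\vdash(\alpha\sqcup\beta)\wedge(\alpha\sqcup\gamma)$; $\bot\vdash\alpha$; $\alpha\vdash\top$; $\neg\top\vdash\bot$; $\top\vdash\lrcorner\bot$; $\neg\bot\dashv\vdash\top\sqcap\top$; $\lrcorner\top\dashv\vdash\bot\sqcup\bot$; $(\alpha\sqcup\alpha)\sqcap(\alpha\sqcup\alpha)\dashv\vdash(\alpha\sqcap\alpha)\sqcup(\alpha\sqcap\alpha)$; $p\sqcap p\dashv\vdash p$ ($p\in\mathbf{OV}$); $P\sqcup P\dashv\vdash P$ ($P\in\mathbf{PV}$); (Sp) $\alpha\vdash\alpha\sqcap\alpha\mid\alpha\sqcup\alpha\vdash\alpha$. Rules: from $B\mid\alpha\vdash\beta\mid C$ infer $B\mid\alpha\sqcap\gamma\vdash\beta\sqcap\gamma\mid C$, $B\mid\gamma\sqcap\alpha\vdash\gamma\sqcap\beta\mid C$, $B\mid\alpha\sqcup\gamma\vdash\beta\sqcup\gamma\mid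 C$, $B\mid\gamma\sqcup\alpha\vdash\gamma\sqcup\beta\mid C$, $B\mid\neg\beta\vdash\neg\alpha\mid C$, $B\mid\lrcorner\beta\vdash\lrcorner\alpha\mid C$; from $B\mid\alpha\vdash\beta\mid C$ and $D\mid\beta\vdash\gamma\mid E$ infer $B\mid D\mid\alpha\vdash\gamma\mid C\mid E$; from $B\mid\alpha\sqcap\beta\vdash\alpha\sqcap\alpha\mid C$, $D\mid\alpha\sqcap\alpha\vdash\alpha\sqcap\beta\mid E$, $F\mid\alpha\sqcup\beta\vdash\beta\sqcup\beta\mid G$, $H\mid\beta\sqcup\beta\vdash\alpha\sqcup\beta\mid X$ infer $B\mid D\mid F\mid H\mid\alpha\vdash\beta\mid C\mid E\mid G\mid X$; external: from $B\mid D\mid D\mid C$ infer $B\mid D\mid C$; from $B\mid D\mid E\mid C$ infer $B\mid E\mid D\mid C$; from $B$ infer $B\mid C$. Provability is via finite derivations. Contexts and semiconcepts. A context is $\mathbb{K}=(G,M,R)$ with sets $G$ (objects), $M$ (properties), $R\subseteq G\times M$. For $A\subseteq G$, $A'=\{m\in M:gRm\text{ for all }g\in A\}$; for $B\subseteq M$, $B'=\{g\in G:gRm\text{ for all }m\in B\}$. A semiconcept is a pair $(A,B)$ with $A'=B$ or $B'=A$; $\mathfrak{H}(\mathbb{K})$ is the set of semiconcepts, with $ext(A,B)=A$, $int(A,B)=B$, and operations $(A_1,B_1)\sqcap(A_2,B_2)=(A_1\cap A_2,(A_1\cap A_2)')$, $(A_1,B_1)\sqcup(A_2,B_2)=((B_1\cap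 B_2)',B_1\cap B_2)$, $\neg(A,B)=(G\setminus A,(G\setminus A)')$, $\lrcorner(A,B)=((M\setminus B)',M\setminus B)$, $\top=(G,\emptyset)$, $\bot=(\emptyset,M)$. Models. A model is $\mathbb{M}=(\mathbb{K},v)$ with $v$ a map on $\mathbf{OV}\cup\mathbf{PV}\cup\{\top,\bot\}$ into $\mathfrak{H}(\mathbb{K})$ with $v(p)\sqcap v(p)=v(p)$ for $p\in\mathbf{OV}$, $v(P)\sqcup v(P)=v(P)$ for $P\in\mathbf{PV}$, $v(\top)=(G,\emptyset)$, $v(\bot)=(\emptyset,M)$. Satisfaction $\mathbb{M},g\models\alpha$ ($g\in G$) and co-satisfaction $\mathbb{M},m\succ\alpha$ ($m\in M$) are defined by: $g\models p$ iff $g\in ext(v(p))$; $g\models P$ iff $g\in ext(v(P))$; $g\models\top$ always; $g\not\models\bot$ always; $m\not\succ\top$ always; $m\succ\bot$ always; $g\models\alpha\sqcap\beta$ iff $g\models\alpha$ and $g\models\beta$; $g\models\neg\alpha$ iff $g\not\models\alpha$; $m\succ p$ iff $m\in int(v(p))$; $m\succ P$ iff $m\in int(v(P))$; $m\succ\alpha\sqcup\beta$ iff $m\succ\alpha$ and $m\succ\beta$; $m\succ\lrcorner\alpha$ iff $m\not\succ\alpha$; $g\models\alpha\sqcup\beta$ iff for all $m\in M$ ($m\succ\alpha\sqcup\beta\Rightarrow gRm$); $g\models\lrcorner\alpha$ iff for all $m\in M$ ($m\not\succ\alpha\Rightarrow gRm$); $m\succ\neg\alpha$ iff for all $g\in G$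 ($g\not\models\alpha\Rightarrow gRm$); $m\succ\alpha\sqcap\beta$ iff for all $g\in G$ ($g\models\alpha\sqcap\beta\Rightarrow gRm$). A sequent $\alpha\vdash\beta$ is satisfied in $\mathbb{M}$ iff for all $g\in G$, $g\models\alpha$ implies $g\models\beta$, and for all $m\in M$, $m\succ\beta$ implies $m\succ\alpha$. An s-hypersequent is satisfied in $\mathbb{M}$ iff at least one component is; it is true in $\mathbb{K}$ iff satisfied in every model based on $\mathbb{K}$; valid in a class of contexts iff true in each member. -}

module Defs where

open import Data.Nat using (ℕ)
open import Data.List using (List; []; _∷_; _++_; [_])
open import Data.List.Relation.Unary.Any using (Any)
open import Data.Product using (_×_; _,_)
open import Data.Sum using (_⊎_; inj₁; inj₂)
open import Data.Unit using (⊤)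
open import Data.Empty using (⊥)
open import Relation.Nullary using (¬_)
open import Function using (id)
open import Function.Bundles using (_⇔_; mk⇔)

infixl 7 _⊓_
infixl 6 _⊔_
infix 4 _⊢_

data Fm : Set where
  ov pv     : ℕ → Fm
  top bot   : Fm
  _⊓_ _⊔_   : Fm → Fm → Fm
  neg cneg  : Fm → Fm

_∨_ : Fm → Fm → Fm
α ∨ β = neg (neg α ⊓ neg β)

_∧_ : Fm → Fm → Fm
α ∧ β = cneg (cneg α ⊔ cneg β)

data Seq : Set where
  _⊢_ : Fm → Fm → Seq

HSeq : Set
HSeq = List Seq

-- Single-sequent axioms (α ⊣⊢ β is listed as two axioms).
data Axiom : Seq → Set where
  ax-id      : ∀ α → Axiom (α ⊢ α)
  ax-⊓₁      : ∀ α β → Axiom (α ⊓ β ⊢ α)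
  ax-⊓₂      : ∀ α β → Axiom (α ⊓ β ⊢ β)
  ax-⊔₁      : ∀ α β → Axiom (α ⊢ α ⊔ β)
  ax-⊔₂      : ∀ α β → Axiom (β ⊢ α ⊔ β)
  ax-⊓dup    : ∀ α β → Axiom (α ⊓ β ⊢ (α ⊓ β) ⊓ (α ⊓ β))
  ax-⊔dup    : ∀ α β → Axiom ((α ⊔ β) ⊔ (α ⊔ β) ⊢ α ⊔ β)
  ax-neg⊓    : ∀ α → Axiom (neg (α ⊓ α) ⊢ neg α)
  ax-cneg⊔   : ∀ α → Axiom (cneg α ⊢ cneg (α ⊔ α))
  ax-contr   : ∀ α → Axiom (α ⊓ neg α ⊢ bot)
  ax-exmid   : ∀ α → Axiom (top ⊢ α ⊔ cneg α)
  ax-nn₁     : ∀ α β → Axiom (neg (neg (α ⊓ β)) ⊢ α ⊓ β)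
  ax-nn₂     : ∀ α β → Axiom (α ⊓ β ⊢ neg (neg (α ⊓ β)))
  ax-cc₁     : ∀ α β → Axiom (cneg (cneg (α ⊔ β)) ⊢ α ⊔ β)
  ax-cc₂     : ∀ α β → Axiom (α ⊔ β ⊢ cneg (cneg (α ⊔ β)))
  ax-abs₁    : ∀ α β → Axiom (α ⊓ α ⊢ α ⊓ (α ⊔ β))
  ax-abs₂    : ∀ α β → Axiom (α ⊔ (α ⊓ β) ⊢ α ⊔ α)
  ax-abs₃    : ∀ α β → Axiom (α ⊓ α ⊢ α ⊓ (α ∨ β))
  ax-abs₄    : ∀ α β → Axiom (α ⊔ (α ∧ β) ⊢ α ⊔ α)
  ax-dist₁   : ∀ α β γ → Axiom (α ⊓ (β ∨ γ) ⊢ (α ⊓ β) ∨ (α ⊓ γ))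
  ax-dist₁'  : ∀ α β γ → Axiom ((α ⊓ β) ∨ (α ⊓ γ) ⊢ α ⊓ (β ∨ γ))
  ax-dist₂   : ∀ α β γ → Axiom (α ⊔ (β ∧ γ) ⊢ (α ⊔ β) ∧ (α ⊔ γ))
  ax-dist₂'  : ∀ α β γ → Axiom ((α ⊔ β) ∧ (α ⊔ γ) ⊢ α ⊔ (β ∧ γ))
  ax-bot     : ∀ α → Axiom (bot ⊢ α)
  ax-top     : ∀ α → Axiom (α ⊢ top)
  ax-negtop  : Axiom (neg top ⊢ bot)
  ax-cnegbot : Axiom (top ⊢ cneg bot)
  ax-negbot₁ : Axiom (neg bot ⊢ top ⊓ top)
  ax-negbot₂ : Axiom (top ⊓ top ⊢ neg bot)
  ax-cnegtop₁ : Axiom (cneg top ⊢ bot ⊔ bot)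
  ax-cnegtop₂ : Axiom (bot ⊔ bot ⊢ cneg top)
  ax-mix₁    : ∀ α → Axiom ((α ⊔ α) ⊓ (α ⊔ α) ⊢ (α ⊓ α) ⊔ (α ⊓ α))
  ax-mix₂    : ∀ α → Axiom ((α ⊓ α) ⊔ (α ⊓ α) ⊢ (α ⊔ α) ⊓ (α ⊔ α))
  ax-ov₁     : ∀ p → Axiom (ov p ⊓ ov p ⊢ ov p)
  ax-ov₂     : ∀ p → Axiom (ov p ⊢ ov p ⊓ ov p)
  ax-pv₁     : ∀ P → Axiom (pv P ⊔ pv P ⊢ pv P)
  ax-pv₂     : ∀ P → Axiom (pv P ⊢ pv P ⊔ pv P)

data Prov : HSeq → Set where
  axiom : ∀ {s} → Axiom s → Prov [ s ]
  sp    : ∀ α → Prov ((α ⊢ α ⊓ α) ∷ (α ⊔ α ⊢ α) ∷ [])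
  ⊓-r   : ∀ {B C α β} γ → Prov (B ++ (α ⊢ β) ∷ C) → Prov (B ++ (α ⊓ γ ⊢ β ⊓ γ) ∷ C)
  ⊓-l   : ∀ {B C α β} γ → Prov (B ++ (α ⊢ β) ∷ C) → Prov (B ++ (γ ⊓ α ⊢ γ ⊓ β) ∷ C)
  ⊔-r   : ∀ {B C α β} γ → Prov (B ++ (α ⊢ β) ∷ C) → Prov (B ++ (α ⊔ γ ⊢ β ⊔ γ) ∷ C)
  ⊔-l   : ∀ {B C α β} γ → Prov (B ++ (α ⊢ β) ∷ C) → Prov (B ++ (γ ⊔ α ⊢ γ ⊔ β) ∷ C)
  neg-r : ∀ {B C α β} → Prov (B ++ (α ⊢ β) ∷ C) → Prov (B ++ (neg β ⊢ neg α) ∷ C)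
  cneg-r : ∀ {B C α β} → Prov (B ++ (α ⊢ β) ∷ C) → Prov (B ++ (cneg β ⊢ cneg α) ∷ C)
  cut   : ∀ {B C D E α β γ} →
          Prov (B ++ (α ⊢ β) ∷ C) → Prov (D ++ (β ⊢ γ) ∷ E) →
          Prov (B ++ D ++ (α ⊢ γ) ∷ C ++ E)
  four  : ∀ {B C D E F G H X α β} →
          Prov (B ++ (α ⊓ β ⊢ α ⊓ α) ∷ C) →
          Prov (D ++ (α ⊓ α ⊢ α ⊓ β) ∷ E) →
          Prov (F ++ (α ⊔ β ⊢ β ⊔ β) ∷ G) →
          Prov (H ++ (β ⊔ β ⊢ α ⊔ β) ∷ X) →
          Prov (B ++ D ++ F ++ H ++ (α ⊢ β) ∷ C ++ E ++ G ++ X)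
  ext-contr : ∀ {B D C} → Prov (B ++ D ++ D ++ C) → Prov (B ++ D ++ C)
  ext-exch  : ∀ {B D E C} → Prov (B ++ D ++ E ++ C) → Prov (B ++ E ++ D ++ C)
  ext-weak  : ∀ {B C} → Prov B → Prov (B ++ C)

record Context : Set₁ where
  field
    Obj  : Set
    Prop : Set
    R    : Obj → Prop → Set

module _ (K : Context) where
  open Context K

  extPrime : (Obj → Set) → Prop → Set
  extPrime A m = ∀ g → A g → R g m

  intPrime : (Prop → Set) → Obj → Set
  intPrime B g = ∀ m → B m → R g m

  record Semiconcept : Set₁ where
    field
      ext  : Obj → Set
      int  : Prop → Set
      semi : (∀ m → int m ⇔ extPrime ext m) ⊎ (∀ g → ext g ⇔ intPrime int g)

  open Semiconcept

  _≈ₛ_ : Semiconcept → Semiconcept → Set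
  x ≈ₛ y = (∀ g → ext x g ⇔ ext y g) × (∀ m → int x m ⇔ int y m)

  _⊓ₛ_ : Semiconcept → Semiconcept → Semiconcept
  x ⊓ₛ y = record
    { ext  = λ g → ext x g × ext y g
    ; int  = extPrime (λ g → ext x g × ext y g)
    ; semi = inj₁ (λ m → mk⇔ id id) }

  _⊔ₛ_ : Semiconcept → Semiconcept → Semiconcept
  x ⊔ₛ y = record
    { ext  = intPrime (λ m → int x m × int y m)
    ; int  = λ m → int x m × int y m
    ; semi = inj₂ (λ g → mk⇔ id id) }

  -- valuations: v(⊤) = (G, ∅) and v(⊥) = (∅, M) are fixed and are used
  -- directly in the satisfaction clauses for top/bot.
  record Valuation : Set₁ where
    field
      vo     : ℕ → Semiconcept
      vp     : ℕ → Semiconcept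
      vo-idem : ∀ p → (vo p ⊓ₛ vo p) ≈ₛ vo p
      vp-idem : ∀ P → (vp P ⊔ₛ vp P) ≈ₛ vp P

  module Sat (v : Valuation) where
    open Valuation v

    mutual
      _⊨_ : Obj → Fm → Set
      g ⊨ ov p     = ext (vo p) g
      g ⊨ pv P     = ext (vp P) g
      g ⊨ top      = ⊤
      g ⊨ bot      = ⊥
      g ⊨ (α ⊓ β)  = (g ⊨ α) × (g ⊨ β)
      g ⊨ neg α    = ¬ (g ⊨ α)
      g ⊨ (α ⊔ β)  = ∀ m → (m ≻ α) × (m ≻ β) → R g m
      g ⊨ cneg α   = ∀ m → ¬ (m ≻ α) → R g m

      _≻_ : Prop → Fm → Set
      m ≻ ov p     = int (vo p) m
      m ≻ pv P     = int (vp P) m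
      m ≻ top      = ⊥
      m ≻ bot      = ⊤
      m ≻ (α ⊔ β)  = (m ≻ α) × (m ≻ β)
      m ≻ cneg α   = ¬ (m ≻ α)
      m ≻ (α ⊓ β)  = ∀ g → (g ⊨ α) × (g ⊨ β) → R g m
      m ≻ neg α    = ∀ g → ¬ (g ⊨ α) → R g m

    SatSeq : Seq → Set
    SatSeq (α ⊢ β) = (∀ g → g ⊨ α → g ⊨ β) × (∀ m → m ≻ β → m ≻ α)

    SatHSeq : HSeq → Set
    SatHSeq H = Any SatSeq H

  TrueIn : HSeq → Set₁
  TrueIn H = (v : Valuation) → Sat.SatHSeq v H

Valid : HSeq → Set₁
Valid H = (K : Context) → TrueIn K H

{-# OPTIONS --safe #-}
-- Every formula denotes a semiconcept, so
-- its extent and intent are incident, and one of them is the derivation of the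
-- other; for formulas headed by ⊓, ¬ or ⊥ it is the intent, for those headed by
-- ⊔, ⌟ or ⊤ the extent. A sequent whose left side is of the first kind therefore
-- holds as soon as its extents are included, and dually, which settles almost all
-- axioms and logical rules. The Boolean laws of ¬ and ⌟ (double negation,
-- distributivity) need excluded middle. The structural rules preserve the set of
-- components, on which satisfaction of an s-hypersequent alone depends.
module Submission where

open import Defs
open import Level using (0ℓ)
open import Axiom.ExcludedMiddle using (ExcludedMiddle)
open import Axiom.DoubleNegationElimination using (DoubleNegationElimination; em⇒dne)
open import Data.List using (List; []; _∷_; _++_)
open import Data.List.Membership.Propositional.Properties using (∈-++⁺ˡ; ∈-++⁺ʳ; ∈-++⁻)
open import Data.List.Relation.Binary.Subset.Propositional using (_⊆_)
open import Data.List.Relation.Binary.Subset.Propositional.Properties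
  using (Any-resp-⊆; xs⊆x∷xs)
  renaming (++⁺ʳ to ++⁺ʳ-⊆)
open import Data.List.Relation.Binary.Permutation.Propositional.Properties
  using (Any-resp-↭; shifts)
  renaming (++⁺ˡ to ++⁺ˡ-↭)
open import Data.List.Relation.Unary.Any using (Any; here; there)
open import Data.List.Relation.Unary.Any.Properties using (++⁺ˡ; ++⁺ʳ)
open import Data.Product using (_,_; proj₁; proj₂)
open import Data.Sum using (_⊎_; inj₁; inj₂; [_,_]′)
import Data.Sum as Sum
open import Data.Unit using (tt)
open import Function using (id; _∘_)
open import Function.Bundles using (Equivalence)
open import Relation.Unary using (Pred)

open Equivalence using (to; from)

module _ {a} {A : Set a} where

  ++-insert-⊆ : ∀ B {y : A} {C} → B ++ C ⊆ B ++ y ∷ C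
  ++-insert-⊆ B {y} {C} = ++⁺ʳ-⊆ B (xs⊆x∷xs C y)

  ++-contract-⊆ : ∀ B D {C : List A} → B ++ D ++ D ++ C ⊆ B ++ D ++ C
  ++-contract-⊆ B D = ++⁺ʳ-⊆ B λ v∈ → [ ∈-++⁺ˡ , id ]′ (∈-++⁻ D v∈)

  cut-⊆ˡ : ∀ B D {y : A} {C E} → B ++ C ⊆ B ++ D ++ y ∷ C ++ E
  cut-⊆ˡ B D v∈ with ∈-++⁻ B v∈
  ... | inj₁ v∈B = ∈-++⁺ˡ v∈B
  ... | inj₂ v∈C = ∈-++⁺ʳ B (∈-++⁺ʳ D (there (∈-++⁺ˡ v∈C)))

  cut-⊆ʳ : ∀ B D {y : A} {C E} → D ++ E ⊆ B ++ D ++ y ∷ C ++ E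
  cut-⊆ʳ B D {C = C} v∈ with ∈-++⁻ D v∈
  ... | inj₁ v∈D = ∈-++⁺ʳ B (∈-++⁺ˡ v∈D)
  ... | inj₂ v∈E = ∈-++⁺ʳ B (∈-++⁺ʳ D (there (∈-++⁺ʳ C v∈E)))

  four-⊆ˡ : ∀ B D F H {y : A} C {E Z} →
            D ++ E ⊆ B ++ D ++ F ++ H ++ y ∷ C ++ E ++ Z
  four-⊆ˡ B D F H C v∈ with ∈-++⁻ D v∈
  ... | inj₁ v∈D = ∈-++⁺ʳ B (∈-++⁺ˡ v∈D)
  ... | inj₂ v∈E =
    ∈-++⁺ʳ B (∈-++⁺ʳ D (∈-++⁺ʳ F (∈-++⁺ʳ H (there (∈-++⁺ʳ C (∈-++⁺ˡ v∈E))))))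

  four-⊆ʳ : ∀ B D F H {y : A} C E {G X} →
            F ++ G ⊆ B ++ D ++ F ++ H ++ y ∷ C ++ E ++ G ++ X
  four-⊆ʳ B D F H C E v∈ with ∈-++⁻ F v∈
  ... | inj₁ v∈F = ∈-++⁺ʳ B (∈-++⁺ʳ D (∈-++⁺ˡ v∈F))
  ... | inj₂ v∈G =
    ∈-++⁺ʳ B (∈-++⁺ʳ D (∈-++⁺ʳ F (∈-++⁺ʳ H (there (∈-++⁺ʳ C (∈-++⁺ʳ E (∈-++⁺ˡ v∈G)))))))

module _ {a p} {A : Set a} {P : Pred A p} where

  Any-focus : ∀ B {x : A} {C} → Any P (B ++ x ∷ C) → P x ⊎ Any P (B ++ C)
  Any-focus []      (here px)  = inj₁ px
  Any-focus []      (there pC) = inj₂ pC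
  Any-focus (_ ∷ B) (here pb)  = inj₂ (here pb)
  Any-focus (_ ∷ B) (there pB) = Sum.map₂ there (Any-focus B pB)

  Any-focus-map : ∀ B {x y : A} {C} → (P x → P y) → Any P (B ++ x ∷ C) → Any P (B ++ y ∷ C)
  Any-focus-map B f = [ ++⁺ʳ B ∘ here ∘ f , Any-resp-⊆ (++-insert-⊆ B) ]′ ∘ Any-focus B

module _ (K : Context) where
  open Context K
  open Semiconcept

  semiconcept-incident : (s : Semiconcept K) → ∀ {g m} → ext s g → int s m → R g m
  semiconcept-incident s {g} {m} a x =
    [ (λ f → to (f m) x g a) , (λ f → to (f g) a m x) ]′ (semi s)

  semiconcept-derived : (s : Semiconcept K) →
    (∀ m → extPrime K (ext s) m → int s m) ⊎ (∀ g → intPrime K (int s) g → ext s g)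
  semiconcept-derived s = Sum.map (λ f m → from (f m)) (λ f g → from (f g)) (semi s)

module Semantics (K : Context) (v : Valuation K) where
  open Context K
  open Valuation v
  open Sat K v

  IntentOfExtent ExtentOfIntent : Fm → Set
  IntentOfExtent φ = ∀ m → (∀ g → g ⊨ φ → R g m) → m ≻ φ
  ExtentOfIntent φ = ∀ g → (∀ m → m ≻ φ → R g m) → g ⊨ φ

  data ExtentGenerated : Fm → Set where
    instance
      ⊓-gen   : ∀ {α β} → ExtentGenerated (α ⊓ β)
      neg-gen : ∀ {α} → ExtentGenerated (neg α)
      bot-gen : ExtentGenerated bot

  data IntentGenerated : Fm → Set where
    instance
      ⊔-gen    : ∀ {α β} → IntentGenerated (α ⊔ β)
      cneg-gen : ∀ {α} → IntentGenerated (cneg α)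
      top-gen  : IntentGenerated top

  intentOfExtent : ∀ {φ} → ExtentGenerated φ → IntentOfExtent φ
  intentOfExtent ⊓-gen   _ h = h
  intentOfExtent neg-gen _ h = h
  intentOfExtent bot-gen _ _ = tt

  extentOfIntent : ∀ {φ} → IntentGenerated φ → ExtentOfIntent φ
  extentOfIntent ⊔-gen    _ h = h
  extentOfIntent cneg-gen _ h = h
  extentOfIntent top-gen  _ _ = tt

  incident : ∀ φ {g m} → g ⊨ φ → m ≻ φ → R g m
  incident (ov p)   = semiconcept-incident K (vo p)
  incident (pv P)   = semiconcept-incident K (vp P)
  incident top      _ ()
  incident bot      ()
  incident (α ⊓ β)  a x = x _ a
  incident (α ⊔ β)  a x = a _ x
  incident (neg α)  a x = x _ a
  incident (cneg α) a x = a _ x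

  semiconcept : ∀ φ → IntentOfExtent φ ⊎ ExtentOfIntent φ
  semiconcept (ov p)   = semiconcept-derived K (vo p)
  semiconcept (pv P)   = semiconcept-derived K (vp P)
  semiconcept top      = inj₂ λ _ _ → tt
  semiconcept bot      = inj₁ λ _ _ → tt
  semiconcept (α ⊓ β)  = inj₁ λ _ h → h
  semiconcept (α ⊔ β)  = inj₂ λ _ h → h
  semiconcept (neg α)  = inj₁ λ _ h → h
  semiconcept (cneg α) = inj₂ λ _ h → h

  extentwise : ∀ α β {{_ : ExtentGenerated α}} → (∀ g → g ⊨ α → g ⊨ β) → SatSeq (α ⊢ β)
  extentwise α β {{gen}} α⊆β =
    α⊆β , λ m x → intentOfExtent gen m λ g a → incident β (α⊆β g a) x

  intentwise : ∀ α β {{_ : IntentGenerated β}} → (∀ m → m ≻ β → m ≻ α) → SatSeq (α ⊢ β)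
  intentwise α β {{gen}} β⊆α =
    (λ g a → extentOfIntent gen g λ m x → incident α a (β⊆α m x)) , β⊆α

  ≻-⊓-self : ∀ α {m} → m ≻ α → m ≻ (α ⊓ α)
  ≻-⊓-self α x _ (a , _) = incident α a x

  ⊨-⊔-self : ∀ α {g} → g ⊨ α → g ⊨ (α ⊔ α)
  ⊨-⊔-self α a _ (x , _) = incident α a x

  ⊔-self-⊓-self-incident : ∀ α {g m} → g ⊨ (α ⊔ α) → m ≻ (α ⊓ α) → R g m
  ⊔-self-⊓-self-incident α {g} {m} hg hm with semiconcept α
  ... | inj₁ intent = hg m (x , x) where x = intent m λ g′ a → hm g′ (a , a)
  ... | inj₂ extent = hm g (a , a) where a = extent g λ m′ x → hg m′ (x , x)

  ⊓-self⊎⊔-self : ∀ α → SatSeq (α ⊢ α ⊓ α) ⊎ SatSeq (α ⊔ α ⊢ α)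
  ⊓-self⊎⊔-self α with semiconcept α
  ... | inj₁ intent = inj₁ ((λ g a → a , a) , λ m h → intent m λ g a → h g (a , a))
  ... | inj₂ extent = inj₂ ((λ g h → extent g λ m x → h m (x , x)) , λ m x → x , x)

  ⊢-trans : ∀ α β γ → SatSeq (α ⊢ β) → SatSeq (β ⊢ γ) → SatSeq (α ⊢ γ)
  ⊢-trans _ _ _ (α⊆β , β⊇α) (β⊆γ , γ⊇β) = (λ g → β⊆γ g ∘ α⊆β g) , (λ m → β⊇α m ∘ γ⊇β m)

  ⊢-via-⊓⊔ : ∀ α β → SatSeq (α ⊓ α ⊢ α ⊓ β) → SatSeq (α ⊔ β ⊢ β ⊔ β) → SatSeq (α ⊢ β)
  ⊢-via-⊓⊔ _ _ (⊓-incl , _) (_ , ⊔-incl) =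
    (λ g a → proj₂ (⊓-incl g (a , a))) , (λ m x → proj₁ (⊔-incl m (x , x)))

  ⊓-monoˡ-⊢ : ∀ α β γ → SatSeq (α ⊢ β) → SatSeq (α ⊓ γ ⊢ β ⊓ γ)
  ⊓-monoˡ-⊢ α β γ (α⊆β , _) = extentwise (α ⊓ γ) (β ⊓ γ) λ g (a , c) → α⊆β g a , c

  ⊓-monoʳ-⊢ : ∀ α β γ → SatSeq (α ⊢ β) → SatSeq (γ ⊓ α ⊢ γ ⊓ β)
  ⊓-monoʳ-⊢ α β γ (α⊆β , _) = extentwise (γ ⊓ α) (γ ⊓ β) λ g (c , a) → c , α⊆β g a

  ⊔-monoˡ-⊢ : ∀ α β γ → SatSeq (α ⊢ β) → SatSeq (α ⊔ γ ⊢ β ⊔ γ)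
  ⊔-monoˡ-⊢ α β γ (_ , β⊇α) = intentwise (α ⊔ γ) (β ⊔ γ) λ m (x , z) → β⊇α m x , z

  ⊔-monoʳ-⊢ : ∀ α β γ → SatSeq (α ⊢ β) → SatSeq (γ ⊔ α ⊢ γ ⊔ β)
  ⊔-monoʳ-⊢ α β γ (_ , β⊇α) = intentwise (γ ⊔ α) (γ ⊔ β) λ m (z , x) → z , β⊇α m x

  neg-antitone-⊢ : ∀ α β → SatSeq (α ⊢ β) → SatSeq (neg β ⊢ neg α)
  neg-antitone-⊢ α β (α⊆β , _) = extentwise (neg β) (neg α) λ g nb a → nb (α⊆β g a)

  cneg-antitone-⊢ : ∀ α β → SatSeq (α ⊢ β) → SatSeq (cneg β ⊢ cneg α)
  cneg-antitone-⊢ α β (_ , β⊇α) = intentwise (cneg β) (cneg α) λ m nx x → nx (β⊇α m x)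

  module _ (dne : DoubleNegationElimination 0ℓ) where

    ∨-⊓-distribˡ : ∀ α β γ {g} → g ⊨ ((α ⊓ β) ∨ (α ⊓ γ)) → g ⊨ (α ⊓ (β ∨ γ))
    ∨-⊓-distribˡ α β γ nn =
      dne (λ na → nn ((λ (a , _) → na a) , (λ (a , _) → na a))) ,
      (λ (nb , nc) → nn ((λ (_ , b) → nb b) , (λ (_ , c) → nc c)))

    ∧-⊔-distribˡ : ∀ α β γ {m} → m ≻ ((α ⊔ β) ∧ (α ⊔ γ)) → m ≻ (α ⊔ (β ∧ γ))
    ∧-⊔-distribˡ α β γ nn =
      dne (λ nx → nn ((λ (x , _) → nx x) , (λ (x , _) → nx x))) ,
      (λ (ny , nz) → nn ((λ (_ , y) → ny y) , (λ (_ , z) → nz z)))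

    axiom-sound : ∀ {s} → Axiom s → SatSeq s
    axiom-sound (ax-id α)  = (λ _ → id) , (λ _ → id)
    axiom-sound (ax-⊓₁ α β) = extentwise (α ⊓ β) α λ _ → proj₁
    axiom-sound (ax-⊓₂ α β) = extentwise (α ⊓ β) β λ _ → proj₂
    axiom-sound (ax-⊔₁ α β) = intentwise α (α ⊔ β) λ _ → proj₁
    axiom-sound (ax-⊔₂ α β) = intentwise β (α ⊔ β) λ _ → proj₂
    axiom-sound (ax-⊓dup α β) =
      extentwise (α ⊓ β) ((α ⊓ β) ⊓ (α ⊓ β)) λ _ ab → ab , ab
    axiom-sound (ax-⊔dup α β) =
      intentwise ((α ⊔ β) ⊔ (α ⊔ β)) (α ⊔ β) λ _ xy → xy , xy
    axiom-sound (ax-neg⊓ α) = extentwise (neg (α ⊓ α)) (neg α) λ _ n a → n (a , a)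
    axiom-sound (ax-cneg⊔ α) = intentwise (cneg α) (cneg (α ⊔ α)) λ _ n x → n (x , x)
    axiom-sound (ax-contr α) = extentwise (α ⊓ neg α) bot λ _ (a , na) → na a
    axiom-sound (ax-exmid α) = intentwise top (α ⊔ cneg α) λ _ (x , nx) → nx x
    axiom-sound (ax-nn₁ α β) = extentwise (neg (neg (α ⊓ β))) (α ⊓ β) λ _ → dne
    axiom-sound (ax-nn₂ α β) = extentwise (α ⊓ β) (neg (neg (α ⊓ β))) λ _ a na → na a
    axiom-sound (ax-cc₁ α β) = intentwise (cneg (cneg (α ⊔ β))) (α ⊔ β) λ _ x nx → nx x
    axiom-sound (ax-cc₂ α β) = intentwise (α ⊔ β) (cneg (cneg (α ⊔ β))) λ _ → dne
    axiom-sound (ax-abs₁ α β) =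
      extentwise (α ⊓ α) (α ⊓ (α ⊔ β)) λ _ (a , _) → a , λ _ (x , _) → incident α a x
    axiom-sound (ax-abs₂ α β) =
      intentwise (α ⊔ (α ⊓ β)) (α ⊔ α) λ _ (x , _) → x , λ _ (a , _) → incident α a x
    axiom-sound (ax-abs₃ α β) =
      extentwise (α ⊓ α) (α ⊓ (α ∨ β)) λ _ (a , _) → a , λ (na , _) → na a
    axiom-sound (ax-abs₄ α β) =
      intentwise (α ⊔ (α ∧ β)) (α ⊔ α) λ _ (x , _) → x , λ (nx , _) → nx x
    axiom-sound (ax-dist₁ α β γ) =
      extentwise (α ⊓ (β ∨ γ)) ((α ⊓ β) ∨ (α ⊓ γ))
        λ _ (a , nn) (nab , nac) → nn ((λ b → nab (a , b)) , (λ c → nac (a , c)))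
    axiom-sound (ax-dist₁' α β γ) =
      extentwise ((α ⊓ β) ∨ (α ⊓ γ)) (α ⊓ (β ∨ γ)) λ _ → ∨-⊓-distribˡ α β γ
    axiom-sound (ax-dist₂ α β γ) =
      intentwise (α ⊔ (β ∧ γ)) ((α ⊔ β) ∧ (α ⊔ γ)) λ _ → ∧-⊔-distribˡ α β γ
    axiom-sound (ax-dist₂' α β γ) =
      intentwise ((α ⊔ β) ∧ (α ⊔ γ)) (α ⊔ (β ∧ γ))
        λ _ (x , nn) (nxy , nxz) → nn ((λ y → nxy (x , y)) , (λ z → nxz (x , z)))
    axiom-sound (ax-bot α) = extentwise bot α λ _ ()
    axiom-sound (ax-top α) = intentwise α top λ _ ()
    axiom-sound ax-negtop = extentwise (neg top) bot λ _ n → n tt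
    axiom-sound ax-cnegbot = intentwise top (cneg bot) λ _ n → n tt
    axiom-sound ax-negbot₁ = extentwise (neg bot) (top ⊓ top) λ _ _ → tt , tt
    axiom-sound ax-negbot₂ = extentwise (top ⊓ top) (neg bot) λ _ _ ()
    axiom-sound ax-cnegtop₁ = intentwise (cneg top) (bot ⊔ bot) λ _ _ ()
    axiom-sound ax-cnegtop₂ = intentwise (bot ⊔ bot) (cneg top) λ _ _ → tt , tt
    axiom-sound (ax-mix₁ α) =
      extentwise ((α ⊔ α) ⊓ (α ⊔ α)) ((α ⊓ α) ⊔ (α ⊓ α))
        λ _ (h , _) _ (k , _) → ⊔-self-⊓-self-incident α h k
    axiom-sound (ax-mix₂ α) =
      (λ _ h → let h′ = λ m (x , _) → h m (≻-⊓-self α x , ≻-⊓-self α x) in h′ , h′) ,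
      (λ _ h → let h′ = λ g (a , _) → h g (⊨-⊔-self α a , ⊨-⊔-self α a) in h′ , h′)
    axiom-sound (ax-ov₁ p) = extentwise (ov p ⊓ ov p) (ov p) λ _ → proj₁
    axiom-sound (ax-ov₂ p) = (λ _ a → a , a) , (λ m → to (proj₂ (vo-idem p) m))
    axiom-sound (ax-pv₁ P) = (λ g → to (proj₁ (vp-idem P) g)) , (λ _ x → x , x)
    axiom-sound (ax-pv₂ P) = intentwise (pv P) (pv P ⊔ pv P) λ _ → proj₁

    sound : ∀ {H} → Prov H → SatHSeq H
    sound (axiom ax) = here (axiom-sound ax)
    sound (sp α) = [ here , there ∘ here ]′ (⊓-self⊎⊔-self α)
    sound (⊓-r {B} {_} {α} {β} γ d) = Any-focus-map B (⊓-monoˡ-⊢ α β γ) (sound d)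
    sound (⊓-l {B} {_} {α} {β} γ d) = Any-focus-map B (⊓-monoʳ-⊢ α β γ) (sound d)
    sound (⊔-r {B} {_} {α} {β} γ d) = Any-focus-map B (⊔-monoˡ-⊢ α β γ) (sound d)
    sound (⊔-l {B} {_} {α} {β} γ d) = Any-focus-map B (⊔-monoʳ-⊢ α β γ) (sound d)
    sound (neg-r {B} {_} {α} {β} d) = Any-focus-map B (neg-antitone-⊢ α β) (sound d)
    sound (cneg-r {B} {_} {α} {β} d) = Any-focus-map B (cneg-antitone-⊢ α β) (sound d)
    sound (cut {B} {_} {D} {_} {α} {β} {γ} d₁ d₂)
      with Any-focus B (sound d₁) | Any-focus D (sound d₂)
    ... | inj₁ αβ | inj₁ βγ = ++⁺ʳ B (++⁺ʳ D (here (⊢-trans α β γ αβ βγ)))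
    ... | inj₂ rest | _ = Any-resp-⊆ (cut-⊆ˡ B D) rest
    ... | inj₁ _ | inj₂ rest = Any-resp-⊆ (cut-⊆ʳ B D) rest
    sound (four {B} {C} {D} {E} {F} {_} {H} {_} {α} {β} _ d₂ d₃ _)
      with Any-focus D (sound d₂) | Any-focus F (sound d₃)
    ... | inj₁ ⊓-incl | inj₁ ⊔-incl =
      ++⁺ʳ B (++⁺ʳ D (++⁺ʳ F (++⁺ʳ H (here (⊢-via-⊓⊔ α β ⊓-incl ⊔-incl)))))
    ... | inj₂ rest | _ = Any-resp-⊆ (four-⊆ˡ B D F H C) rest
    ... | inj₁ _ | inj₂ rest = Any-resp-⊆ (four-⊆ʳ B D F H C E) rest
    sound (ext-contr {B} {D} d) = Any-resp-⊆ (++-contract-⊆ B D) (sound d)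
    sound (ext-exch {B} {D} {E} d) = Any-resp-↭ (++⁺ˡ-↭ B (shifts D E)) (sound d)
    sound (ext-weak d) = ++⁺ˡ (sound d)

theorem66 : ExcludedMiddle 0ℓ → (H : HSeq) → Prov H → Valid H
theorem66 em H d K v = Semantics.sound K v (em⇒dne em) d
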